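{- Let $m=p_1\cdots p_t$ be a product of distinct odd primes, let $\{\mathbf{u}_x,\mathbf{v}_x\in\mathbb{Z}_m^d : x\in\{0,1\}^\ell\}$ be a matching-vector family over $\mathbb{Z}_m^d$, and let $\mathbf{x},\mathbf{y}\in\mathbb{Z}_m^d$ and $a,b\in\{0,1\}^\ell$. Let $g_1=\langle\mathbf{x},\mathbf{v}_a\rangle$ and $g_2=\langle\mathbf{y},\mathbf{v}_b\rangle$ (in $\mathbb{Z}_m$). For $i\in[t]$ let $$f_i(X)=X^{g_1g_2\bmod p_i}-X^{(g_1+1)g_2\bmod p_i}-X^{g_1(g_2+1)\bmod p_i}+X^{(g_1+1)(g_2+1)\bmod p_i}\in\mathbb{Z}[X]$$ (exponents taken in $\{0,\ldots,p_i-1\}$), and let $\alpha_iX^{\beta_i}$ be the lexicographically first nonzero monomial of $f_i$ (so $\alpha_i\neq 0$, $\beta_i\in\mathbb{Z}_{p_i}$). Then for any $i\in[t]$ and $r,s\in\{0,1\}^\ell$, $$\sum_{\substack{\epsilon,\delta\in\{0,1\}\\ \langle\mathbf{x}+\epsilon\mathbf{u}_a,\mathbf{v}_r\rangle\cdot\langle\mathbf{y}+\delta\mathbf{u}_b,\mathbf{v}_s\rangle\equiv\beta_i\pmod{p_i}}}(-1)^{\epsilon+\delta}=\begin{cases}\alpha_i & \text{if }(r,s)=(a,b),\\ 0 & \text{if }\langle\mathbf{u}_a,\mathbf{v}_r\rangle\cdot\langle\mathbf{u}_b,\mathbf{v}_s\rangle\equiv 0\pmod{p_i}.\end{cases}$$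 (In all other cases the value is arbitrary.)
   Context: A matching-vector family over $\mathbb{Z}_m^d$ indexed by $\{0,1\}^\ell$ consists of vectors $\mathbf{u}_x,\mathbf{v}_x\in\mathbb{Z}_m^d$ with $\langle\mathbf{u}_x,\mathbf{v}_y\rangle\in\{0,1\}\pmod{p_k}$ for every $k\in[t]$, and $\langle\mathbf{u}_x,\mathbf{v}_y\rangle=1$ in $\mathbb{Z}_m$ iff $x=y$. -}

module Defs where

open import Data.Nat as ℕ using (ℕ; zero; suc; _+_; _*_)
open import Data.Nat.DivMod using (_%_)
open import Data.Nat.Primality using (Prime; prime⇒nonZero)
open import Data.Fin as Fin using (Fin; toℕ)
open import Data.Vec using (Vec)
open import Data.Bool using (Bool; true; false; if_then_else_)
open import Data.List using (map; allFin)
open import Data.Nat.ListAction using (product)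
open import Data.Integer as ℤ using (ℤ; 0ℤ; 1ℤ; -1ℤ; +_)
import Data.Integer.Divisibility as ℤDiv
open import Data.Product using (_×_)
open import Data.Sum using (_⊎_)
open import Function using (_∘_; _⇔_)
open import Relation.Nullary using (¬_)
open import Relation.Nullary.Decidable using (⌊_⌋)
open import Relation.Binary.PropositionalEquality using (_≡_)

∏ : ∀ {t} → (Fin t → ℕ) → ℕ
∏ {t} p = product (map p (allFin t))

_≡_[mod_] : ℕ → ℕ → ℕ → Set
a ≡ b [mod n ] = (+ n) ℤDiv.∣ ((+ a) ℤ.- (+ b))

residue : ℕ → (p : ℕ) → Prime p → ℕ
residue a p pp = _%_ a p {{prime⇒nonZero pp}}

ℤ[_]^ : ℕ → ℕ → Set
ℤ[ m ]^ d = Fin d → Fin m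

∑ : ∀ {d} → (Fin d → ℕ) → ℕ
∑ {zero} f = 0
∑ {suc d} f = f Fin.zero + ∑ (f ∘ Fin.suc)

ip : ∀ {d} → (Fin d → ℕ) → (Fin d → ℕ) → ℕ
ip x y = ∑ (λ j → x j * y j)

rep : ∀ {m d} → ℤ[ m ]^ d → (Fin d → ℕ)
rep x j = toℕ (x j)

-- ⟨x , y⟩ for x, y ∈ ℤ_m^d (a representative in ℕ of the value in ℤ_m)
⟨_,_⟩ : ∀ {m d} → ℤ[ m ]^ d → ℤ[ m ]^ d → ℕ
⟨ x , y ⟩ = ip (rep x) (rep y)

b2n : Bool → ℕ
b2n false = 0
b2n true = 1

_+[_]·_ : ∀ {m d} → ℤ[ m ]^ d → Bool → ℤ[ m ]^ d → (Fin d → ℕ)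
(x +[ ε ]· u) j = toℕ (x j) + b2n ε * toℕ (u j)

record MVFamily {t} (p : Fin t → ℕ) (d ℓ : ℕ) : Set where
  field
    u v : Vec Bool ℓ → ℤ[ ∏ p ]^ d
    mod-p-01 : ∀ x y k →
      (⟨ u x , v y ⟩ ≡ 0 [mod p k ]) ⊎ (⟨ u x , v y ⟩ ≡ 1 [mod p k ])
    match : ∀ x y → (⟨ u x , v y ⟩ ≡ 1 [mod ∏ p ]) ⇔ (x ≡ y)

-- Coefficient of X^e in
-- f(X) = X^{g₁g₂ mod p} − X^{(g₁+1)g₂ mod p} − X^{g₁(g₂+1) mod p} + X^{(g₁+1)(g₂+1) mod p} ∈ ℤ[X]
fCoeff : (p : ℕ) → Prime p → (g₁ g₂ : ℕ) → ℕ → ℤ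
fCoeff p pp g₁ g₂ e =
  ((ind (g₁ * g₂) ℤ.- ind ((g₁ + 1) * g₂)) ℤ.- ind (g₁ * (g₂ + 1)))
    ℤ.+ ind ((g₁ + 1) * (g₂ + 1))
  where
  ind : ℕ → ℤ
  ind n = if ⌊ residue n p pp ℕ.≟ e ⌋ then 1ℤ else 0ℤ

-- α X^β is the lexicographically first nonzero monomial of the polynomial
-- with coefficient function c (lex order on univariate monomials: X^a ≻ X^b iff a > b,
-- so this is the nonzero monomial of highest degree)
IsLexFirstMonomial : (ℕ → ℤ) → ℤ → ℕ → Set
IsLexFirstMonomial c α β = ¬ (α ≡ 0ℤ) × (c β ≡ α) × (∀ e → β ℕ.< e → c e ≡ 0ℤ)

sgn : Bool → Bool → ℤ
sgn ε δ = -1ℤ ℤ.^ (b2n ε + b2n δ)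

signedCount : (p : ℕ) → Prime p → (A B : Bool → ℕ) → ℕ → ℤ
signedCount p pp A B β = term false false ℤ.+ term false true ℤ.+ term true false ℤ.+ term true true
  where
  term : Bool → Bool → ℤ
  term ε δ = if ⌊ residue (A ε * B δ) p pp ℕ.≟ β ⌋ then sgn ε δ else 0ℤ

-- For a fixed prime p = pᵢ, linearity of the inner product gives
-- ⟨x + εuₐ, vᵣ⟩ = ⟨x, vᵣ⟩ + ε⟨uₐ, vᵣ⟩, so the four products in the signed count
-- are affine in ε and in δ. If (r, s) = (a, b), both slopes are 1 mod p, the four
-- residues are the exponents of fᵢ with the matching signs, and the signed count is
-- the coefficient of X^β in fᵢ, which is α. If p divides the product of the slopes,
-- it divides one of them, the residues do not depend on ε (or on δ), and the terms
-- cancel in pairs.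
module Submission where

open import Defs
open import Data.Nat using (ℕ; _*_)
open import Data.Nat.Divisibility using (_∣_)
open import Data.Nat.Primality using (Prime)
open import Data.Fin using (Fin)
open import Data.Vec using (Vec)
open import Data.Bool using (Bool)
open import Data.Integer using (ℤ; 0ℤ)
open import Data.Product using (_×_; _,_)
open import Function using (Injective)
open import Relation.Nullary using (¬_)
open import Relation.Binary.PropositionalEquality using (_≡_)

open import Data.Nat using (zero; suc; _+_; _∸_; _≤_; _≟_; NonZero)
open import Data.Nat.Properties using (*-zeroʳ; *-identityʳ; +-identityʳ; ≤-total; m+[n∸m]≡n)
open import Data.Nat.DivMod using (_%_; %-congˡ; %-distribˡ-+; %-distribˡ-*; %-remove-+ʳ)
open import Data.Nat.Divisibility using (∣-trans; ∣n⇒∣m*n)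
open import Data.Nat.Primality using (prime⇒nonZero; euclidsLemma)
open import Data.Nat.ListAction.Properties using (∈⇒∣product)
open import Data.Nat.Tactic.RingSolver as ℕSolver using ()
import Data.Fin as Fin
open import Data.List.Membership.Propositional.Properties using (∈-allFin; ∈-map⁺)
open import Data.Bool using (true; false; if_then_else_)
open import Data.Integer as ℤ using (1ℤ; -1ℤ; _-_; ∣_∣; _⊖_)
open import Data.Integer.Properties as ℤ using (m-n≡m⊖n; ∣m⊖n∣≡∣n⊖m∣; ∣⊖∣-≤)
open import Data.Integer.Tactic.RingSolver as ℤSolver using ()
open import Data.Sum using (inj₁; inj₂)
open import Relation.Nullary using (yes; no)
open import Relation.Nullary.Decidable using (⌊_⌋)
open import Relation.Binary.PropositionalEquality using (refl; sym; trans; cong; cong₂; subst; module ≡-Reasoning)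
open import Function using (_∘_; Equivalence)

open ≡-Reasoning

ip-linearˡ : ∀ {d} (x u w : Fin d → ℕ) k →
  ip (λ j → x j + k * u j) w ≡ ip x w + k * ip u w
ip-linearˡ {zero}  x u w k = sym (*-zeroʳ k)
ip-linearˡ {suc d} x u w k = begin
  (x₀ + k * u₀) * w₀ + ip (λ j → x (Fin.suc j) + k * u (Fin.suc j)) (w ∘ Fin.suc)
    ≡⟨ cong ((x₀ + k * u₀) * w₀ +_) (ip-linearˡ (x ∘ Fin.suc) (u ∘ Fin.suc) (w ∘ Fin.suc) k) ⟩
  (x₀ + k * u₀) * w₀ + (ip (x ∘ Fin.suc) (w ∘ Fin.suc) + k * ip (u ∘ Fin.suc) (w ∘ Fin.suc))
    ≡⟨ regroup x₀ u₀ w₀ (ip (x ∘ Fin.suc) (w ∘ Fin.suc)) (ip (u ∘ Fin.suc) (w ∘ Fin.suc)) k ⟩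
  (x₀ * w₀ + ip (x ∘ Fin.suc) (w ∘ Fin.suc)) + k * (u₀ * w₀ + ip (u ∘ Fin.suc) (w ∘ Fin.suc)) ∎
  where
  x₀ = x Fin.zero
  u₀ = u Fin.zero
  w₀ = w Fin.zero
  regroup : ∀ a b c s t k → (a + k * b) * c + (s + k * t) ≡ (a * c + s) + k * (b * c + t)
  regroup = ℕSolver.solve-∀

ip-+[]· : ∀ {m d} (x u w : ℤ[ m ]^ d) ε →
  ip (x +[ ε ]· u) (rep w) ≡ ⟨ x , w ⟩ + b2n ε * ⟨ u , w ⟩
ip-+[]· x u w ε = ip-linearˡ (rep x) (rep u) (rep w) (b2n ε)

∣∏ : ∀ {t} (p : Fin t → ℕ) i → p i ∣ ∏ p
∣∏ p i = ∈⇒∣product (∈-map⁺ p (∈-allFin i))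

≡0[mod]⇒∣ : ∀ {a n} → a ≡ 0 [mod n ] → n ∣ a
≡0[mod]⇒∣ {a} {n} = subst (n ∣_) (cong ∣_∣ (ℤ.+-identityʳ (ℤ.+ a)))

module _ {n : ℕ} .{{_ : NonZero n}} where

  ∣∸⇒%≡ : ∀ {a b} → b ≤ a → n ∣ a ∸ b → a % n ≡ b % n
  ∣∸⇒%≡ {a} {b} b≤a n∣a∸b = begin
    a % n             ≡⟨ %-congˡ (m+[n∸m]≡n b≤a) ⟨
    (b + (a ∸ b)) % n ≡⟨ %-remove-+ʳ b n∣a∸b ⟩
    b % n             ∎

  ∣∣⊖∣⇒%≡ : ∀ {a b} → n ∣ ∣ a ⊖ b ∣ → a % n ≡ b % n
  ∣∣⊖∣⇒%≡ {a} {b} n∣a⊖b with ≤-total a b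
  ... | inj₁ a≤b = sym (∣∸⇒%≡ a≤b (subst (n ∣_) (∣⊖∣-≤ a≤b) n∣a⊖b))
  ... | inj₂ b≤a = ∣∸⇒%≡ b≤a (subst (n ∣_) (trans (∣m⊖n∣≡∣n⊖m∣ a b) (∣⊖∣-≤ b≤a)) n∣a⊖b)

  ≡[mod]⇒%≡ : ∀ {a b} → a ≡ b [mod n ] → a % n ≡ b % n
  ≡[mod]⇒%≡ {a} {b} = ∣∣⊖∣⇒%≡ ∘ subst (n ∣_) (cong ∣_∣ (m-n≡m⊖n a b))

  %-cong-+ : ∀ {a a′ b b′} → a % n ≡ a′ % n → b % n ≡ b′ % n → (a + b) % n ≡ (a′ + b′) % n
  %-cong-+ {a} {a′} {b} {b′} a≈a′ b≈b′ = begin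
    (a + b) % n             ≡⟨ %-distribˡ-+ a b n ⟩
    (a % n + b % n) % n     ≡⟨ cong₂ (λ i j → (i + j) % n) a≈a′ b≈b′ ⟩
    (a′ % n + b′ % n) % n   ≡⟨ %-distribˡ-+ a′ b′ n ⟨
    (a′ + b′) % n           ∎

  %-cong-* : ∀ {a a′ b b′} → a % n ≡ a′ % n → b % n ≡ b′ % n → (a * b) % n ≡ (a′ * b′) % n
  %-cong-* {a} {a′} {b} {b′} a≈a′ b≈b′ = begin
    (a * b) % n             ≡⟨ %-distribˡ-* a b n ⟩
    (a % n * (b % n)) % n   ≡⟨ cong₂ (λ i j → (i * j) % n) a≈a′ b≈b′ ⟩
    (a′ % n * (b′ % n)) % n ≡⟨ %-distribˡ-* a′ b′ n ⟨
    (a′ * b′) % n           ∎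

𝟙[_≡_] : ℕ → ℕ → ℤ
𝟙[ n ≡ β ] = if ⌊ n ≟ β ⌋ then 1ℤ else 0ℤ

if≟-then-else-0 : ∀ s n β → (if ⌊ n ≟ β ⌋ then s else 0ℤ) ≡ s ℤ.* 𝟙[ n ≡ β ]
if≟-then-else-0 s n β with n ≟ β
... | yes _ = sym (ℤ.*-identityʳ s)
... | no _  = sym (ℤ.*-zeroʳ s)

module _ {p : ℕ} (pp : Prime p) (β : ℕ) where

  private instance
    p-nonZero : NonZero p
    p-nonZero = prime⇒nonZero pp

  signedCount-expand : ∀ A B →
    signedCount p pp A B β
      ≡ ((𝟙[ (A false * B false) % p ≡ β ] - 𝟙[ (A true * B false) % p ≡ β ])
          - 𝟙[ (A false * B true) % p ≡ β ]) ℤ.+ 𝟙[ (A true * B true) % p ≡ β ]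
  signedCount-expand A B =
    trans (cong₂ ℤ._+_ (cong₂ ℤ._+_ (cong₂ ℤ._+_ (hit false false) (hit false true)) (hit true false))
                       (hit true true))
          (regroup (𝟙[ (A false * B false) % p ≡ β ]) (𝟙[ (A false * B true) % p ≡ β ])
                   (𝟙[ (A true * B false) % p ≡ β ]) (𝟙[ (A true * B true) % p ≡ β ]))
    where
    hit : ∀ ε δ → (if ⌊ (A ε * B δ) % p ≟ β ⌋ then sgn ε δ else 0ℤ)
                   ≡ sgn ε δ ℤ.* 𝟙[ (A ε * B δ) % p ≡ β ]
    hit ε δ = if≟-then-else-0 (sgn ε δ) ((A ε * B δ) % p) β
    regroup : ∀ w x y z → 1ℤ ℤ.* w ℤ.+ -1ℤ ℤ.* x ℤ.+ -1ℤ ℤ.* y ℤ.+ 1ℤ ℤ.* z ≡ ((w - y) - x) ℤ.+ z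
    regroup = ℤSolver.solve-∀

  signedCount-cong : ∀ {A A′ B B′} → (∀ ε → A ε % p ≡ A′ ε % p) → (∀ δ → B δ % p ≡ B′ δ % p) →
    signedCount p pp A B β ≡ signedCount p pp A′ B′ β
  signedCount-cong {A} {A′} {B} {B′} A≈A′ B≈B′ =
    cong₂ ℤ._+_ (cong₂ ℤ._+_ (cong₂ ℤ._+_ (hit false false) (hit false true)) (hit true false))
                (hit true true)
    where
    hit : ∀ ε δ → (if ⌊ (A ε * B δ) % p ≟ β ⌋ then sgn ε δ else 0ℤ)
                   ≡ (if ⌊ (A′ ε * B′ δ) % p ≟ β ⌋ then sgn ε δ else 0ℤ)
    hit ε δ = cong (λ n → if ⌊ n ≟ β ⌋ then sgn ε δ else 0ℤ)
                   (%-cong-* {a = A ε} {A′ ε} {B δ} {B′ δ} (A≈A′ ε) (B≈B′ δ))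

  signedCount-+b2n : ∀ g₁ g₂ →
    signedCount p pp (λ ε → g₁ + b2n ε) (λ δ → g₂ + b2n δ) β ≡ fCoeff p pp g₁ g₂ β
  signedCount-+b2n g₁ g₂
    -- the expansion is fCoeff itself, up to g + 0 = g
    rewrite signedCount-expand (λ ε → g₁ + b2n ε) (λ δ → g₂ + b2n δ)
          | +-identityʳ g₁ | +-identityʳ g₂
          = refl

  signedCount-constˡ : ∀ a B → signedCount p pp (λ _ → a) B β ≡ 0ℤ
  signedCount-constˡ a B = trans (signedCount-expand (λ _ → a) B)
                                 (cancel 𝟙[ (a * B false) % p ≡ β ] 𝟙[ (a * B true) % p ≡ β ])
    where
    cancel : ∀ w x → ((w - w) - x) ℤ.+ x ≡ 0ℤ
    cancel = ℤSolver.solve-∀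

  signedCount-constʳ : ∀ A b → signedCount p pp A (λ _ → b) β ≡ 0ℤ
  signedCount-constʳ A b = trans (signedCount-expand A (λ _ → b))
                                 (cancel 𝟙[ (A false * b) % p ≡ β ] 𝟙[ (A true * b) % p ≡ β ])
    where
    cancel : ∀ w x → ((w - x) - w) ℤ.+ x ≡ 0ℤ
    cancel = ℤSolver.solve-∀

  %-affine-slope≡1 : ∀ h k {c} → c % p ≡ 1 % p → (h + k * c) % p ≡ (h + k) % p
  %-affine-slope≡1 h k {c} c≈1 = begin
    (h + k * c) % p ≡⟨ %-cong-+ {a = h} refl (%-cong-* {a = k} refl c≈1) ⟩
    (h + k * 1) % p ≡⟨ cong (λ j → (h + j) % p) (*-identityʳ k) ⟩
    (h + k) % p     ∎

  signedCount-affine-slopes≡1 : ∀ h₁ h₂ {c₁ c₂} → c₁ % p ≡ 1 % p → c₂ % p ≡ 1 % p →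
    signedCount p pp (λ ε → h₁ + b2n ε * c₁) (λ δ → h₂ + b2n δ * c₂) β ≡ fCoeff p pp h₁ h₂ β
  signedCount-affine-slopes≡1 h₁ h₂ c₁≈1 c₂≈1 =
    trans (signedCount-cong {A′ = λ ε → h₁ + b2n ε} {B′ = λ δ → h₂ + b2n δ}
                            (λ ε → %-affine-slope≡1 h₁ (b2n ε) c₁≈1)
                            (λ δ → %-affine-slope≡1 h₂ (b2n δ) c₂≈1))
          (signedCount-+b2n h₁ h₂)

  signedCount-affine-slope∣ˡ : ∀ h {c} B → p ∣ c →
    signedCount p pp (λ ε → h + b2n ε * c) B β ≡ 0ℤ
  signedCount-affine-slope∣ˡ h B p∣c =
    trans (signedCount-cong {A′ = λ _ → h} {B′ = B}
                            (λ ε → %-remove-+ʳ h (∣n⇒∣m*n (b2n ε) p∣c)) (λ _ → refl))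
          (signedCount-constˡ h B)

  signedCount-affine-slope∣ʳ : ∀ A h {c} → p ∣ c →
    signedCount p pp A (λ δ → h + b2n δ * c) β ≡ 0ℤ
  signedCount-affine-slope∣ʳ A h p∣c =
    trans (signedCount-cong {A′ = A} {B′ = λ _ → h}
                            (λ _ → refl) (λ δ → %-remove-+ʳ h (∣n⇒∣m*n (b2n δ) p∣c)))
          (signedCount-constʳ A h)

lemma3p9 : (t d ℓ : ℕ) (p : Fin t → ℕ) (prime : ∀ k → Prime (p k))
  → (∀ k → ¬ (2 ∣ p k)) → Injective _≡_ _≡_ p
  → (F : MVFamily p d ℓ)
  → (x y : ℤ[ ∏ p ]^ d) (a b : Vec Bool ℓ)
  → let open MVFamily F
        g₁ = ⟨ x , v a ⟩
        g₂ = ⟨ y , v b ⟩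
    in (i : Fin t) (α : ℤ) (β : ℕ)
    → IsLexFirstMonomial (fCoeff (p i) (prime i) g₁ g₂) α β
    → (r s : Vec Bool ℓ)
    → let S = signedCount (p i) (prime i)
                (λ ε → ip (x +[ ε ]· u a) (rep (v r)))
                (λ δ → ip (y +[ δ ]· u b) (rep (v s))) β
      in (((r , s) ≡ (a , b)) → S ≡ α)
       × ((⟨ u a , v r ⟩ * ⟨ u b , v s ⟩) ≡ 0 [mod p i ] → S ≡ 0ℤ)
lemma3p9 _ _ _ p prime _ _ F x y a b i α β (_ , f[β]≡α , _) r s = matched , orthogonal
  where
  open MVFamily F
  instance
    pᵢ-nonZero : NonZero (p i)
    pᵢ-nonZero = prime⇒nonZero (prime i)

  S : ℤ
  S = signedCount (p i) (prime i) (λ ε → ip (x +[ ε ]· u a) (rep (v r)))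
                                  (λ δ → ip (y +[ δ ]· u b) (rep (v s))) β

  h₁ h₂ c₁ c₂ : ℕ
  h₁ = ⟨ x , v r ⟩
  h₂ = ⟨ y , v s ⟩
  c₁ = ⟨ u a , v r ⟩
  c₂ = ⟨ u b , v s ⟩

  A B : Bool → ℕ
  A ε = h₁ + b2n ε * c₁
  B δ = h₂ + b2n δ * c₂

  S≡affine : S ≡ signedCount (p i) (prime i) A B β
  S≡affine = signedCount-cong (prime i) β (λ ε → cong (_% p i) (ip-+[]· x (u a) (v r) ε))
                                          (λ δ → cong (_% p i) (ip-+[]· y (u b) (v s) δ))

  ⟨u,v⟩≡1 : ∀ c → ⟨ u c , v c ⟩ % p i ≡ 1 % p i
  ⟨u,v⟩≡1 c = ≡[mod]⇒%≡ (∣-trans (∣∏ p i) (Equivalence.from (match c c) refl))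

  matched : (r , s) ≡ (a , b) → S ≡ α
  matched refl = begin
    S                                 ≡⟨ S≡affine ⟩
    signedCount (p i) (prime i) A B β
      ≡⟨ signedCount-affine-slopes≡1 (prime i) β h₁ h₂ (⟨u,v⟩≡1 a) (⟨u,v⟩≡1 b) ⟩
    fCoeff (p i) (prime i) h₁ h₂ β    ≡⟨ f[β]≡α ⟩
    α                                 ∎

  orthogonal : (c₁ * c₂) ≡ 0 [mod p i ] → S ≡ 0ℤ
  orthogonal c₁c₂≡0 with euclidsLemma c₁ c₂ (prime i) (≡0[mod]⇒∣ c₁c₂≡0)
  ... | inj₁ p∣c₁ = trans S≡affine (signedCount-affine-slope∣ˡ (prime i) β h₁ B p∣c₁)
  ... | inj₂ p∣c₂ = trans S≡affine (signedCount-affine-slope∣ʳ (prime i) β A h₂ p∣c₂)
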